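{- Let $G$ be a finite simple bipartite graph with (non-empty) partite sets $U$ and $W$. Then $$\mathcal M(G)=\max_{\emptyset\ne X\subseteq U,\ \emptyset\ne Y\subseteq W}\frac{e(X,Y)}{\sqrt{|X||Y|}}.$$
   Context: For subsets $X,Y$ of the vertex set $V=U\cup W$, $e(X,Y)$ is the number of ordered pairs $(x,y)\in X\times Y$ with $xy$ an edge of $G$ (for $X\subseteq U$, $Y\subseteq W$ this is the number of edges between $X$ and $Y$), and $\mathcal M(G):=\max_{\emptyset\ne X,Y\subseteq V}e(X,Y)/\sqrt{|X||Y|}$. -}

module Defs where

open import Data.Nat using (ℕ; _*_; _≤_)
open import Data.Bool using (Bool; true; false; _∧_; if_then_else_)
open import Data.Fin using (Fin)
open import Data.Fin.Subset using (Subset; _∈_; _⊆_; Nonempty; ∣_∣)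
open import Data.Vec using (lookup)
open import Data.List using (map; allFin)
open import Data.Nat.ListAction using (sum)
open import Data.Product using (∃; _×_)
open import Relation.Binary.PropositionalEquality using (_≡_; _≢_)
open import Relation.Nullary using (¬_)

-- A finite simple bipartite graph on vertex set V = Fin n, with partite
-- sets U = {v | side v ≡ true} and W = {v | side v ≡ false}.
record BipartiteGraph (n : ℕ) : Set where
  field
    adj       : Fin n → Fin n → Bool
    symmetric : ∀ u v → adj u v ≡ adj v u
    loopless  : ∀ v → adj v v ≡ false
    side      : Fin n → Bool
    bipartite : ∀ u v → adj u v ≡ true → side u ≢ side v
    U-nonempty : ∃ λ u → side u ≡ true
    W-nonempty : ∃ λ w → side w ≡ false

module _ {n : ℕ} (G : BipartiteGraph n) where
  open BipartiteGraph G

  InU : Subset n → Set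
  InU X = ∀ x → x ∈ X → side x ≡ true

  InW : Subset n → Set
  InW Y = ∀ y → y ∈ Y → side y ≡ false

  e : Subset n → Subset n → ℕ
  e X Y = sum (map (λ x → sum (map (λ y →
            if lookup X x ∧ lookup Y y ∧ adj x y then 1 else 0) (allFin n))) (allFin n))

-- Comparison of the (non-negative real) ratios
--   a / sqrt(p)  ≤  b / sqrt(q)     (p, q > 0, a, b ≥ 0)
-- which is equivalent to  a² · q ≤ b² · p.
RatioLe : (a p b q : ℕ) → Set
RatioLe a p b q = a * a * q ≤ b * b * p

{-# OPTIONS --safe #-}
-- Since G is bipartite, splitting X and Y along the bipartition gives
-- e(X,Y) = e(X∩U, Y∩W) + e(X∩W, Y∩U).  If c is the largest ratio attained by a pair
-- inside U × W (one exists: the candidates are finitely many and include two singletons),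
-- the two terms are at most c√(|X∩U||Y∩W|) and c√(|X∩W||Y∩U|), and their sum is at most
-- c√(|X||Y|) because √(pq) + √(rs) ≤ √((p + r)(q + s)).
module Submission where

open import Defs
open import Data.Nat using (ℕ; _*_)
open import Data.Fin.Subset using (Subset; Nonempty; ∣_∣)
open import Data.Product using (Σ; _×_)

open import Level using (0ℓ)
open import Data.Nat using (zero; suc; _+_; _≤_; _<_; _≤?_; z≤n; >-nonZero)
open import Data.Nat.Properties
  using ( ≤-total; ≰⇒>; <⇒≱; +-suc; +-comm; *-comm; +-identityʳ; m≤n⇒∃[o]m+o≡n; m≤m+n
        ; *-mono-<; *-mono-≤; *-monoˡ-≤; *-monoʳ-≤; +-mono-≤; *-cancelʳ-≤; +-0-commutativeMonoid
        ; module ≤-Reasoning)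
open import Data.Nat.Tactic.RingSolver using (solve-∀)
open import Data.Nat.ListAction using (sum)
open import Algebra.Properties.CommutativeMonoid.Sum +-0-commutativeMonoid
  using (sum-syntax; sum-cong-≗; sum-replicate-zero; ∑-distrib-+; ∑-comm)
open import Data.Bool using (true; false; not; _∧_; if_then_else_)
import Data.Bool.Properties as Bool
open import Data.Fin using (Fin; zero; suc)
open import Data.Fin.Properties using (all?)
open import Data.Fin.Subset using (_∈_; _⊆_; inside; outside; ⁅_⁆; _∩_; ∁)
open import Data.Fin.Subset.Properties
  using (nonempty?; _∈?_; x∈⁅x⁆; x∈⁅y⁆⇒x≡y; ∣⁅x⁆∣≡1; p⊆q⇒∣p∣≤∣q∣; x∈p∩q⁻; x∈∁p⇒x∉p)
open import Data.Vec using ([]; _∷_; lookup; tabulate)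
open import Data.Vec.Properties
  using (lookup∘tabulate; lookup-zipWith; lookup-map; []=⇒lookup; lookup⇒[]=)
open import Data.List using (List; []; _∷_; [_]; map; allFin; cartesianProduct; _++_)
open import Data.List.Properties using (map-tabulate)
open import Data.List.Relation.Unary.Any using (Any; here; there; any?)
import Data.List.Membership.Propositional as List
open import Data.List.Membership.Propositional.Properties
  using (∈-map⁺; ∈-++⁺ˡ; ∈-++⁺ʳ; ∈-cartesianProduct⁺)
open import Data.Product using (_,_; ∃; proj₁; proj₂)
open import Data.Sum using (_⊎_; inj₁; inj₂; [_,_]′; reduce)
open import Function using (_∘_)
open import Relation.Nullary using (¬_; Dec; yes; no; contradiction)
open import Relation.Nullary.Decidable using (_→-dec_; _×-dec_)
open import Relation.Unary using (Pred; Decidable)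
open import Relation.Binary using (Rel; Total)
open import Relation.Binary.PropositionalEquality
  using (_≡_; _≢_; refl; sym; trans; cong; cong₂; subst; subst₂; module ≡-Reasoning)

m*m≤n*n⇒m≤n : ∀ {m n} → m * m ≤ n * n → m ≤ n
m*m≤n*n⇒m≤n {m} {n} m*m≤n*n with m ≤? n
... | yes m≤n = m≤n
... | no m≰n = contradiction m*m≤n*n (<⇒≱ (*-mono-< n<m n<m))
  where n<m = ≰⇒> m≰n

4xy≤[x+y]² : ∀ x y → 4 * (x * y) ≤ (x + y) * (x + y)
4xy≤[x+y]² x y = [ ordered , ordered-swapped ]′ (≤-total x y)
  where
  ordered : ∀ {x y} → x ≤ y → 4 * (x * y) ≤ (x + y) * (x + y)
  ordered {x} x≤y with m≤n⇒∃[o]m+o≡n x≤y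
  ... | d , refl = subst (4 * (x * (x + d)) ≤_) (expand x d) (m≤m+n _ (d * d))
    where
    expand : ∀ x d → 4 * (x * (x + d)) + d * d ≡ (x + (x + d)) * (x + (x + d))
    expand = solve-∀
  ordered-swapped : y ≤ x → 4 * (x * y) ≤ (x + y) * (x + y)
  ordered-swapped y≤x =
    subst₂ _≤_ (cong (4 *_) (*-comm y x)) (cong (λ s → s * s) (+-comm y x)) (ordered y≤x)

RatioLe-total : ∀ a p b q → RatioLe a p b q ⊎ RatioLe b q a p
RatioLe-total a p b q = ≤-total (a * a * q) (b * b * p)

RatioLe-trans : ∀ a p b q c r → 0 < q → RatioLe a p b q → RatioLe b q c r → RatioLe a p c r
RatioLe-trans a p b q c r 0<q a≤b b≤c = *-cancelʳ-≤ _ _ q ⦃ >-nonZero 0<q ⦄ (begin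
  a * a * r * q  ≡⟨ swap a r q ⟩
  a * a * q * r  ≤⟨ *-monoˡ-≤ r a≤b ⟩
  b * b * p * r  ≡⟨ swap b p r ⟩
  b * b * r * p  ≤⟨ *-monoˡ-≤ p b≤c ⟩
  c * c * q * p  ≡⟨ swap c q p ⟩
  c * c * p * q  ∎)
  where
  open ≤-Reasoning
  swap : ∀ a u v → a * a * u * v ≡ a * a * v * u
  swap = solve-∀

RatioLe-+ : ∀ a b c r x₁ y₁ x₂ y₂ →
  RatioLe a (x₁ * y₁) c r → RatioLe b (x₂ * y₂) c r →
  RatioLe (a + b) ((x₁ + x₂) * (y₁ + y₂)) c r
RatioLe-+ a b c r x₁ y₁ x₂ y₂ a≤c b≤c = begin
  (a + b) * (a + b) * r                         ≡⟨ expandˡ a b r ⟩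
  a * a * r + b * b * r + 2 * (a * b * r)       ≤⟨ +-mono-≤ (+-mono-≤ a≤c b≤c) cross ⟩
  c * c * (x₁ * y₁) + c * c * (x₂ * y₂) + c * c * (x₁ * y₂ + x₂ * y₁)
                                                ≡⟨ expandʳ (c * c) x₁ y₁ x₂ y₂ ⟩
  c * c * ((x₁ + x₂) * (y₁ + y₂))               ∎
  where
  open ≤-Reasoning
  expandˡ : ∀ a b r → (a + b) * (a + b) * r ≡ a * a * r + b * b * r + 2 * (a * b * r)
  expandˡ = solve-∀
  expandʳ : ∀ k x₁ y₁ x₂ y₂ →
    k * (x₁ * y₁) + k * (x₂ * y₂) + k * (x₁ * y₂ + x₂ * y₁) ≡ k * ((x₁ + x₂) * (y₁ + y₂))
  expandʳ = solve-∀
  regroupˡ : ∀ a b r → 2 * (a * b * r) * (2 * (a * b * r)) ≡ 4 * (a * a * r * (b * b * r))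
  regroupˡ = solve-∀
  regroupʳ : ∀ k x₁ y₁ x₂ y₂ →
    4 * (k * (x₁ * y₁) * (k * (x₂ * y₂))) ≡ k * k * (4 * (x₁ * y₂ * (x₂ * y₁)))
  regroupʳ = solve-∀
  square-* : ∀ k s → k * k * (s * s) ≡ k * s * (k * s)
  square-* = solve-∀
  -- The cross term of (a + b)² is bounded through its square, by AM-GM on x₁y₂ and x₂y₁.
  cross : 2 * (a * b * r) ≤ c * c * (x₁ * y₂ + x₂ * y₁)
  cross = m*m≤n*n⇒m≤n (begin
    2 * (a * b * r) * (2 * (a * b * r))                   ≡⟨ regroupˡ a b r ⟩
    4 * (a * a * r * (b * b * r))                         ≤⟨ *-monoʳ-≤ 4 (*-mono-≤ a≤c b≤c) ⟩
    4 * (c * c * (x₁ * y₁) * (c * c * (x₂ * y₂)))         ≡⟨ regroupʳ (c * c) x₁ y₁ x₂ y₂ ⟩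
    c * c * (c * c) * (4 * (x₁ * y₂ * (x₂ * y₁)))
                                      ≤⟨ *-monoʳ-≤ (c * c * (c * c)) (4xy≤[x+y]² (x₁ * y₂) (x₂ * y₁)) ⟩
    c * c * (c * c) * ((x₁ * y₂ + x₂ * y₁) * (x₁ * y₂ + x₂ * y₁))
                                                          ≡⟨ square-* (c * c) _ ⟩
    c * c * (x₁ * y₂ + x₂ * y₁) * (c * c * (x₁ * y₂ + x₂ * y₁)) ∎)

module _ {A : Set} (P : Pred A 0ℓ) (_≲_ : Rel A 0ℓ) where

  IsGreatestIn : List A → A → Set
  IsGreatestIn xs m = P m × (∀ {y} → y List.∈ xs → P y → y ≲ m)

module _ {A : Set} {P : Pred A 0ℓ} {_≲_ : Rel A 0ℓ} (P? : Decidable P)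
         (≲-total : Total _≲_) (≲-trans : ∀ {x y z} → P y → x ≲ y → y ≲ z → x ≲ z) where

  private
    ≲-refl : ∀ {x} → x ≲ x
    ≲-refl {x} = reduce (≲-total x x)

    greatest-∷ : ∀ {x xs m} → P x → IsGreatestIn P _≲_ xs m → ∃ (IsGreatestIn P _≲_ (x ∷ xs))
    greatest-∷ {x} {xs} {m} px (pm , xs≲m) with ≲-total m x
    ... | inj₁ m≲x = x , px , λ
      { (here refl) _ → ≲-refl
      ; (there y∈xs) py → ≲-trans pm (xs≲m y∈xs py) m≲x }
    ... | inj₂ x≲m = m , pm , λ { (here refl) _ → x≲m ; (there y∈xs) py → xs≲m y∈xs py }

  greatest : ∀ xs → Any P xs → ∃ (IsGreatestIn P _≲_ xs)
  greatest (x ∷ xs) (here px) with any? P? xs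
  ... | yes P[xs] = greatest-∷ px (proj₂ (greatest xs P[xs]))
  ... | no ¬P[xs] = x , px , λ
    { (here refl) _ → ≲-refl
    ; (there y∈xs) py → contradiction (List.lose y∈xs py) ¬P[xs] }
  greatest (x ∷ xs) (there P[xs]) with P? x
  ... | yes px = greatest-∷ px (proj₂ (greatest xs P[xs]))
  ... | no ¬px = let m , pm , xs≲m = greatest xs P[xs] in
    m , pm , λ { (here refl) px → contradiction px ¬px ; (there y∈xs) py → xs≲m y∈xs py }

allSubsets : ∀ n → List (Subset n)
allSubsets zero    = [ [] ]
allSubsets (suc n) = map (outside ∷_) (allSubsets n) ++ map (inside ∷_) (allSubsets n)

∈-allSubsets : ∀ {n} (p : Subset n) → p List.∈ allSubsets n
∈-allSubsets []            = here refl
∈-allSubsets (outside ∷ p) = ∈-++⁺ˡ (∈-map⁺ (outside ∷_) (∈-allSubsets p))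
∈-allSubsets (inside ∷ p)  =
  ∈-++⁺ʳ (map (outside ∷_) (allSubsets _)) (∈-map⁺ (inside ∷_) (∈-allSubsets p))

nonempty⇒∣p∣>0 : ∀ {n} {p : Subset n} → Nonempty p → 0 < ∣ p ∣
nonempty⇒∣p∣>0 {p = p} (x , x∈p) =
  subst (_≤ ∣ p ∣) (∣⁅x⁆∣≡1 x) (p⊆q⇒∣p∣≤∣q∣ ⁅x⁆⊆p)
  where
  ⁅x⁆⊆p : ⁅ x ⁆ ⊆ p
  ⁅x⁆⊆p y∈⁅x⁆ = subst (_∈ p) (sym (x∈⁅y⁆⇒x≡y x y∈⁅x⁆)) x∈p

∣p∣≡∣q∩p∣+∣∁q∩p∣ : ∀ {n} (q p : Subset n) → ∣ p ∣ ≡ ∣ q ∩ p ∣ + ∣ ∁ q ∩ p ∣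
∣p∣≡∣q∩p∣+∣∁q∩p∣ []            []            = refl
∣p∣≡∣q∩p∣+∣∁q∩p∣ (inside ∷ q)  (inside ∷ p)  = cong suc (∣p∣≡∣q∩p∣+∣∁q∩p∣ q p)
∣p∣≡∣q∩p∣+∣∁q∩p∣ (inside ∷ q)  (outside ∷ p) = ∣p∣≡∣q∩p∣+∣∁q∩p∣ q p
∣p∣≡∣q∩p∣+∣∁q∩p∣ (outside ∷ q) (inside ∷ p)  =
  trans (cong suc (∣p∣≡∣q∩p∣+∣∁q∩p∣ q p)) (sym (+-suc _ _))
∣p∣≡∣q∩p∣+∣∁q∩p∣ (outside ∷ q) (outside ∷ p) = ∣p∣≡∣q∩p∣+∣∁q∩p∣ q p

sum-map-allFin : ∀ {n} (f : Fin n → ℕ) → sum (map f (allFin n)) ≡ ∑[ i < n ] f i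
sum-map-allFin {n} f = trans (cong sum (map-tabulate (λ i → i) f)) (sum-tabulate f)
  where
  sum-tabulate : ∀ {n} (f : Fin n → ℕ) → sum (Data.List.tabulate f) ≡ ∑[ i < n ] f i
  sum-tabulate {zero}  f = refl
  sum-tabulate {suc n} f = cong (f zero +_) (sum-tabulate (f ∘ suc))

module _ {n : ℕ} (G : BipartiteGraph n) where
  open BipartiteGraph G

  edge : Subset n → Subset n → Fin n → Fin n → ℕ
  edge A B x y = if lookup A x ∧ lookup B y ∧ adj x y then 1 else 0

  e≡∑∑edge : ∀ A B → e G A B ≡ ∑[ x < n ] ∑[ y < n ] edge A B x y
  e≡∑∑edge A B = trans (sum-map-allFin (λ x → sum (map (edge A B x) (allFin n))))
                       (sum-cong-≗ (λ x → sum-map-allFin (edge A B x)))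

  edge-comm : ∀ A B x y → edge A B x y ≡ edge B A y x
  edge-comm A B x y rewrite symmetric x y with lookup A x | lookup B y
  ... | false | false = refl
  ... | false | true  = refl
  ... | true  | false = refl
  ... | true  | true  = refl

  e-comm : ∀ A B → e G A B ≡ e G B A
  e-comm A B = begin
    e G A B                                  ≡⟨ e≡∑∑edge A B ⟩
    ∑[ x < n ] ∑[ y < n ] edge A B x y       ≡⟨ ∑-comm (edge A B) ⟩
    ∑[ y < n ] ∑[ x < n ] edge A B x y
      ≡⟨ sum-cong-≗ (λ y → sum-cong-≗ (λ x → edge-comm A B x y)) ⟩
    ∑[ y < n ] ∑[ x < n ] edge B A y x       ≡⟨ sym (e≡∑∑edge B A) ⟩
    e G B A                                  ∎
    where open ≡-Reasoning

  edge-split : ∀ S A B x y → edge A B x y ≡ edge (S ∩ A) B x y + edge (∁ S ∩ A) B x y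
  edge-split S A B x y
    rewrite lookup-zipWith _∧_ x S A | lookup-zipWith _∧_ x (∁ S) A | lookup-map x not S
    with lookup S x
  ... | true  = sym (+-identityʳ _)
  ... | false = refl

  e-split : ∀ S A B → e G A B ≡ e G (S ∩ A) B + e G (∁ S ∩ A) B
  e-split S A B = begin
    e G A B                                                ≡⟨ e≡∑∑edge A B ⟩
    ∑[ x < n ] row A x                                     ≡⟨ sum-cong-≗ split-row ⟩
    ∑[ x < n ] (row (S ∩ A) x + row (∁ S ∩ A) x)           ≡⟨ ∑-distrib-+ (row (S ∩ A)) (row (∁ S ∩ A)) ⟩
    ∑[ x < n ] row (S ∩ A) x + ∑[ x < n ] row (∁ S ∩ A) x  ≡⟨ sym (cong₂ _+_ (e≡∑∑edge (S ∩ A) B)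
                                                                             (e≡∑∑edge (∁ S ∩ A) B)) ⟩
    e G (S ∩ A) B + e G (∁ S ∩ A) B                        ∎
    where
    open ≡-Reasoning
    row : Subset n → Fin n → ℕ
    row A′ x = ∑[ y < n ] edge A′ B x y
    split-row : ∀ x → row A x ≡ row (S ∩ A) x + row (∁ S ∩ A) x
    split-row x = trans (sum-cong-≗ (edge-split S A B x)) (∑-distrib-+ (edge (S ∩ A) B x) (edge (∁ S ∩ A) B x))

  e-no-edges : ∀ A B → (∀ {x y} → x ∈ A → y ∈ B → adj x y ≢ true) → e G A B ≡ 0
  e-no-edges A B no-edge = begin
    e G A B                             ≡⟨ e≡∑∑edge A B ⟩
    ∑[ x < n ] ∑[ y < n ] edge A B x y
      ≡⟨ sum-cong-≗ (λ x → trans (sum-cong-≗ (edge≡0 x)) (sum-replicate-zero n)) ⟩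
    ∑[ x < n ] 0                        ≡⟨ sum-replicate-zero n ⟩
    0                                   ∎
    where
    open ≡-Reasoning
    edge≡0 : ∀ x y → edge A B x y ≡ 0
    edge≡0 x y with lookup A x in x∈A | lookup B y in y∈B | adj x y in xy
    ... | false | _     | _     = refl
    ... | true  | false | _     = refl
    ... | true  | true  | false = refl
    ... | true  | true  | true  =
      contradiction xy (no-edge (lookup⇒[]= x A x∈A) (lookup⇒[]= y B y∈B))

  e-splitʳ : ∀ S A B → e G A B ≡ e G A (S ∩ B) + e G A (∁ S ∩ B)
  e-splitʳ S A B = begin
    e G A B                             ≡⟨ e-comm A B ⟩
    e G B A                             ≡⟨ e-split S B A ⟩
    e G (S ∩ B) A + e G (∁ S ∩ B) A     ≡⟨ cong₂ _+_ (e-comm (S ∩ B) A) (e-comm (∁ S ∩ B) A) ⟩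
    e G A (S ∩ B) + e G A (∁ S ∩ B)     ∎
    where open ≡-Reasoning

  e-emptyˡ : ∀ {A} B → ¬ Nonempty A → e G A B ≡ 0
  e-emptyˡ {A} B A-empty = e-no-edges A B (λ x∈A _ _ → A-empty (_ , x∈A))

  e-emptyʳ : ∀ A {B} → ¬ Nonempty B → e G A B ≡ 0
  e-emptyʳ A {B} B-empty = e-no-edges A B (λ _ y∈B _ → B-empty (_ , y∈B))

  U W : Subset n
  U = tabulate side
  W = ∁ U

  ∈U⇒side≡true : ∀ {x} → x ∈ U → side x ≡ true
  ∈U⇒side≡true {x} x∈U = trans (sym (lookup∘tabulate side x)) ([]=⇒lookup x∈U)

  ∈W⇒side≡false : ∀ {x} → x ∈ W → side x ≡ false
  ∈W⇒side≡false {x} x∈W with side x in side-x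
  ... | false = refl
  ... | true  = contradiction (lookup⇒[]= x U (trans (lookup∘tabulate side x) side-x)) (x∈∁p⇒x∉p x∈W)

  InU-U∩ : ∀ X → InU G (U ∩ X)
  InU-U∩ X x x∈U∩X = ∈U⇒side≡true (proj₁ (x∈p∩q⁻ U X x∈U∩X))

  InW-W∩ : ∀ X → InW G (W ∩ X)
  InW-W∩ X x x∈W∩X = ∈W⇒side≡false (proj₁ (x∈p∩q⁻ W X x∈W∩X))

  e-same-side : ∀ {A B} s → (∀ x → x ∈ A → side x ≡ s) → (∀ y → y ∈ B → side y ≡ s) →
    e G A B ≡ 0
  e-same-side {A} {B} s A-on-s B-on-s = e-no-edges A B λ {x} {y} x∈A y∈B xy →
    bipartite x y xy (trans (A-on-s x x∈A) (sym (B-on-s y y∈B)))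

  e-bipartite : ∀ X Y → e G X Y ≡ e G (U ∩ X) (W ∩ Y) + e G (W ∩ X) (U ∩ Y)
  e-bipartite X Y = begin
    e G X Y                                            ≡⟨ e-split U X Y ⟩
    e G (U ∩ X) Y + e G (W ∩ X) Y
      ≡⟨ cong₂ _+_ (e-splitʳ U (U ∩ X) Y) (e-splitʳ U (W ∩ X) Y) ⟩
    (e G (U ∩ X) (U ∩ Y) + e G (U ∩ X) (W ∩ Y)) + (e G (W ∩ X) (U ∩ Y) + e G (W ∩ X) (W ∩ Y))
      ≡⟨ cong₂ (λ u w → (u + a) + (b + w)) within-U within-W ⟩
    a + (b + 0)                                        ≡⟨ cong (a +_) (+-identityʳ b) ⟩
    e G (U ∩ X) (W ∩ Y) + e G (W ∩ X) (U ∩ Y)          ∎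
    where
    open ≡-Reasoning
    a = e G (U ∩ X) (W ∩ Y)
    b = e G (W ∩ X) (U ∩ Y)
    within-U = e-same-side true (InU-U∩ X) (InU-U∩ Y)
    within-W = e-same-side false (InW-W∩ X) (InW-W∩ Y)

  IsCandidate : Pred (Subset n × Subset n) 0ℓ
  IsCandidate (X , Y) = Nonempty X × InU G X × Nonempty Y × InW G Y

  _≤ratio_ : Rel (Subset n × Subset n) 0ℓ
  (X , Y) ≤ratio (X′ , Y′) = RatioLe (e G X Y) (∣ X ∣ * ∣ Y ∣) (e G X′ Y′) (∣ X′ ∣ * ∣ Y′ ∣)

  isCandidate? : Decidable IsCandidate
  isCandidate? (X , Y) = nonempty? X ×-dec InU? X ×-dec nonempty? Y ×-dec InW? Y
    where
    InU? : ∀ X → Dec (InU G X)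
    InU? X = all? (λ x → (x ∈? X) →-dec (side x Bool.≟ true))
    InW? : ∀ Y → Dec (InW G Y)
    InW? Y = all? (λ y → (y ∈? Y) →-dec (side y Bool.≟ false))

  -- A pair with an empty side would compare both above and below everything.
  ≤ratio-trans : ∀ {p q r} → IsCandidate q → p ≤ratio q → q ≤ratio r → p ≤ratio r
  ≤ratio-trans {X , Y} {X′ , Y′} {X″ , Y″} (X′-ne , _ , Y′-ne , _) =
    RatioLe-trans (e G X Y) (∣ X ∣ * ∣ Y ∣) (e G X′ Y′) (∣ X′ ∣ * ∣ Y′ ∣) (e G X″ Y″) (∣ X″ ∣ * ∣ Y″ ∣)
      (*-mono-< (nonempty⇒∣p∣>0 X′-ne) (nonempty⇒∣p∣>0 Y′-ne))

  singletons-candidate : IsCandidate (⁅ proj₁ U-nonempty ⁆ , ⁅ proj₁ W-nonempty ⁆)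
  singletons-candidate =
    (u , x∈⁅x⁆ u) , on-side (proj₂ U-nonempty) , (w , x∈⁅x⁆ w) , on-side (proj₂ W-nonempty)
    where
    u = proj₁ U-nonempty
    w = proj₁ W-nonempty
    on-side : ∀ {s v} → side v ≡ s → ∀ x → x ∈ ⁅ v ⁆ → side x ≡ s
    on-side side-v x x∈⁅v⁆ = trans (cong side (x∈⁅y⁆⇒x≡y _ x∈⁅v⁆)) side-v

  candidate-dominates-all : ∀ X* Y* →
    (∀ {A B} → IsCandidate (A , B) → (A , B) ≤ratio (X* , Y*)) →
    ∀ X Y → (X , Y) ≤ratio (X* , Y*)
  candidate-dominates-all X* Y* dominates X Y =
    subst₂ (λ a p → RatioLe a p c r) (sym (e-bipartite X Y)) (sym sizes)
      (RatioLe-+ (e G (U ∩ X) (W ∩ Y)) (e G (W ∩ X) (U ∩ Y)) c r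
                 (∣ U ∩ X ∣) (∣ W ∩ Y ∣) (∣ W ∩ X ∣) (∣ U ∩ Y ∣)
                 (dominates-UW (InU-U∩ X) (InW-W∩ Y)) dominates-WU)
    where
    c = e G X* Y*
    r = ∣ X* ∣ * ∣ Y* ∣
    dominates-UW : ∀ {A B} → InU G A → InW G B → (A , B) ≤ratio (X* , Y*)
    dominates-UW {A} {B} A⊆U B⊆W with nonempty? A | nonempty? B
    ... | yes A-ne | yes B-ne = dominates (A-ne , A⊆U , B-ne , B⊆W)
    ... | no A-empty | _ rewrite e-emptyˡ B A-empty = z≤n
    ... | yes _ | no B-empty rewrite e-emptyʳ A B-empty = z≤n
    dominates-WU : (W ∩ X , U ∩ Y) ≤ratio (X* , Y*)
    dominates-WU = subst₂ (λ a p → RatioLe a p c r)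
      (e-comm (U ∩ Y) (W ∩ X)) (*-comm (∣ U ∩ Y ∣) (∣ W ∩ X ∣)) (dominates-UW (InU-U∩ Y) (InW-W∩ X))
    sizes : ∣ X ∣ * ∣ Y ∣ ≡ (∣ U ∩ X ∣ + ∣ W ∩ X ∣) * (∣ W ∩ Y ∣ + ∣ U ∩ Y ∣)
    sizes = cong₂ _*_ (∣p∣≡∣q∩p∣+∣∁q∩p∣ U X)
                      (trans (∣p∣≡∣q∩p∣+∣∁q∩p∣ U Y) (+-comm (∣ U ∩ Y ∣) (∣ W ∩ Y ∣)))

  ≤ratio-total : Total _≤ratio_
  ≤ratio-total (X , Y) (X′ , Y′) =
    RatioLe-total (e G X Y) (∣ X ∣ * ∣ Y ∣) (e G X′ Y′) (∣ X′ ∣ * ∣ Y′ ∣)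

  optimal-pair : Σ (Subset n × Subset n) λ (X* , Y*) →
    IsCandidate (X* , Y*) × (∀ X Y → (X , Y) ≤ratio (X* , Y*))
  optimal-pair =
    let (X* , Y*) , candidate , dominates =
          greatest isCandidate? ≤ratio-total (λ {p} {q} {r} → ≤ratio-trans {p} {q} {r})
                   pairs (List.lose (∈-pairs _ _) singletons-candidate)
    in (X* , Y*) , candidate , candidate-dominates-all X* Y* (λ {A} {B} → dominates (∈-pairs A B))
    where
    pairs = cartesianProduct (allSubsets n) (allSubsets n)
    ∈-pairs : ∀ X Y → (X , Y) List.∈ pairs
    ∈-pairs X Y = ∈-cartesianProduct⁺ (∈-allSubsets X) (∈-allSubsets Y)

claim1 : (n : ℕ) (G : BipartiteGraph n) →
    Σ (Subset n) λ X → Σ (Subset n) λ Y →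
      (Nonempty X × InU G X × Nonempty Y × InW G Y) ×
      ((X' Y' : Subset n) → Nonempty X' → Nonempty Y' →
        RatioLe (e G X' Y') (∣ X' ∣ * ∣ Y' ∣) (e G X Y) (∣ X ∣ * ∣ Y ∣))
claim1 n G =
  let (X* , Y*) , candidate , optimal = optimal-pair G
  in X* , Y* , candidate , λ X′ Y′ _ _ → optimal X′ Y′
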